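{- For integers $n\ge 0$, $i\ge 0$, $j\ge 0$ let $p^{2n}_{i,j}$ denote the number of Dyck paths of length $2n$ that are $j$-ped at level $i$. Then: (1) $p^0_{0,1}=1$ and $p^0_{0,j}=0$ for $j\neq 1$; (2) $p^2_{0,2}=1$ and $p^2_{0,j}=0$ for $j\neq 2$; (3) for $n>1$: $p^{2n}_{0,0}=0$, $p^{2n}_{0,1}=0$, and $p^{2n}_{0,2}=\sum_{k=0}^{\infty}p^{2(n-1)}_{0,k}$; (4) for $n>1$ and $j>2$: $\displaystyle p^{2n}_{0,j}=\sum_{i=0}^{n-2}p^{2(i+1)}_{0,2}\,p^{2(n-i-1)}_{0,j-1}$.
   Context: A Dyck path of length $2n$ is a lattice path from $(0,0)$ to $(2n,0)$ using steps $U=(1,1)$ and $D=(1,-1)$ that never goes below the $x$-axis; the path of length $0$ is the null path. A Dyck path has $2n+1$ vertices (lattice points visited, including both endpoints). The path is called $j$-ped at level $i$ if exactly $j$ of its vertices have $y$-coordinate $i$ (each such vertex is called a foot at level $i$). -}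

module Defs where

open import Data.Nat using (ℕ; zero; suc; _+_; _*_)
open import Data.Integer using (ℤ; +_; _-_) renaming (_+_ to _+ℤ_; _≤_ to _≤ℤ_)
import Data.Integer as ℤ
open import Data.Bool using (Bool; true; false; _∧_)
open import Data.List using (List; []; _∷_; length; filter; map; concatMap; upTo)
open import Data.Nat.ListAction using (sum)
open import Data.Product using (_×_; _,_)
open import Relation.Nullary.Decidable using (⌊_⌋)
open import Relation.Binary.PropositionalEquality using (_≡_)

-- Steps U = (1,1) and D = (1,-1).
data Step : Set where
  U D : Step

stepΔ : Step → ℤ
stepΔ U = + 1
stepΔ D = ℤ.-[1+ 0 ]

-- y-coordinates of all vertices of the path starting at height h
-- (a path with m steps has m+1 vertices).
heightsFrom : ℤ → List Step → List ℤ
heightsFrom h []       = h ∷ []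
heightsFrom h (s ∷ ss) = h ∷ heightsFrom (h +ℤ stepΔ s) ss

heights : List Step → List ℤ
heights = heightsFrom (+ 0)

lastℤ : List ℤ → ℤ
lastℤ []       = + 0
lastℤ (x ∷ []) = x
lastℤ (x ∷ xs) = lastℤ xs

allNonneg : List ℤ → Bool
allNonneg []       = true
allNonneg (x ∷ xs) = ⌊ + 0 ℤ.≤? x ⌋ ∧ allNonneg xs

isDyck : List Step → Bool
isDyck ss = allNonneg (heights ss) ∧ ⌊ lastℤ (heights ss) ℤ.≟ + 0 ⌋

allWords : ℕ → List (List Step)
allWords zero    = [] ∷ []
allWords (suc m) = concatMap (λ w → (U ∷ w) ∷ (D ∷ w) ∷ []) (allWords m)

dyckPaths : ℕ → List (List Step)
dyckPaths n = filter (λ w → isDyck w Data.Bool.≟ true) (allWords (2 * n))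
  where import Data.Bool

-- number of vertices of the path with y-coordinate i (feet at level i)
feet : ℕ → List Step → ℕ
feet i ss = length (filter (λ y → y ℤ.≟ + i) (heights ss))

-- p n i j = p^{2n}_{i,j}: number of Dyck paths of length 2n that are j-ped at level i.
p : ℕ → ℕ → ℕ → ℕ
p n i j = length (filter (λ w → feet i w Data.Nat.≟ j) (dyckPaths n))
  where import Data.Nat

Σ< : ℕ → (ℕ → ℕ) → ℕ
Σ< N f = sum (map f (upTo N))

module Submission where

-- A Dyck path is a word over {U, D}, so p n 0 j counts
-- the words of length 2n that, read from height 0, stay nonnegative, end
-- at 0 and meet level 0 exactly j times.  Allowing any start height h
-- gives a count  walks m h j  with a recursion on the first step, and
-- Sections 1-3 show  p n 0 j ≡ walks (2 * n) 0 j.  After basic facts on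
-- finite sums and convolutions (Section 4), Section 5 proves the
-- combinatorics of walks: every walk from 0 has a foot at each end;
-- walks from 0 have even length; cutting a walk at its first visit of
-- level 0 writes `walks` as a convolution of first-passage numbers with
-- walks from 0, so a walk with j+1 feet is a first excursion (a walk with
-- two feet) followed by a walk with j feet; and a walk with two feet is
-- U, a lifted walk, D.

open import Defs
open import Data.Nat using (ℕ; zero; suc; _+_; _*_; _∸_; _≤_; _<_; s≤s)
import Data.Nat as ℕ
open import Data.Nat.Properties
  using (+-identityʳ; +-comm; +-assoc; +-suc; *-suc; *-identityʳ; *-zeroʳ; *-distribʳ-+;
         n∸n≡0; ∸-+-assoc; ≤-trans; n≤1+n; +-commutativeSemigroup)
open import Algebra.Properties.CommutativeSemigroup +-commutativeSemigroup using (interchange)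
open import Data.Integer using (ℤ; +_)
import Data.Integer as ℤ
open import Data.Bool using (Bool; true; false; _∧_; if_then_else_)
import Data.Bool as Bool
open import Data.Bool.Properties using (∧-zeroʳ)
open import Data.List using (List; []; _∷_; length; filter; map; concatMap; applyUpTo)
open import Data.Nat.ListAction using (sum)
open import Data.Product using (_×_; _,_)
open import Data.Empty using (⊥-elim)
open import Function using (_∘_; id)
open import Relation.Unary using (Decidable)
open import Relation.Nullary.Decidable using (⌊_⌋; yes; no; isYes≗does)
open import Relation.Binary.PropositionalEquality
open ≡-Reasoning

-- Section 1.  Counting Boolean predicates on lists

indicator : Bool → ℕ
indicator b = if b then 1 else 0

count : {A : Set} → (A → Bool) → List A → ℕ
count f []       = 0
count f (x ∷ xs) = indicator (f x) + count f xs

length-filter-filter : {A : Set} {P Q : A → Set} (P? : Decidable P) (Q? : Decidable Q)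
  (xs : List A) → length (filter P? (filter Q? xs)) ≡ count (λ x → ⌊ Q? x ⌋ ∧ ⌊ P? x ⌋) xs
length-filter-filter P? Q? [] = refl
length-filter-filter P? Q? (x ∷ xs) with Q? x
... | no _ = length-filter-filter P? Q? xs
... | yes _ with P? x
...   | no _  = length-filter-filter P? Q? xs
...   | yes _ = cong suc (length-filter-filter P? Q? xs)

count-cong : {A : Set} {f g : A → Bool} → (∀ x → f x ≡ g x) → ∀ xs → count f xs ≡ count g xs
count-cong f≗g []       = refl
count-cong f≗g (x ∷ xs) = cong₂ _+_ (cong indicator (f≗g x)) (count-cong f≗g xs)

count-false : {A : Set} (xs : List A) → count (λ _ → false) xs ≡ 0
count-false []       = refl
count-false (x ∷ xs) = count-false xs

count-branch : (f : List Step → Bool) (ws : List (List Step)) →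
  count f (concatMap (λ w → (U ∷ w) ∷ (D ∷ w) ∷ []) ws)
    ≡ count (f ∘ (U ∷_)) ws + count (f ∘ (D ∷_)) ws
count-branch f []       = refl
count-branch f (w ∷ ws) = begin
  firstU + (firstD + count f (concatMap (λ v → (U ∷ v) ∷ (D ∷ v) ∷ []) ws))
    ≡⟨ cong (λ rest → firstU + (firstD + rest)) (count-branch f ws) ⟩
  firstU + (firstD + (restU + restD)) ≡⟨ sym (+-assoc firstU firstD (restU + restD)) ⟩
  (firstU + firstD) + (restU + restD) ≡⟨ interchange firstU firstD restU restD ⟩
  (firstU + restU) + (firstD + restD) ∎
  where
  firstU firstD restU restD : ℕ
  firstU = indicator (f (U ∷ w))
  firstD = indicator (f (D ∷ w))
  restU = count (f ∘ (U ∷_)) ws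
  restD = count (f ∘ (D ∷_)) ws

-- Section 2.  Walks and their count

-- walks m h j: the number of words of length m which, read from height
-- h, never go below 0, end at height 0 and have exactly j vertices at
-- height 0.  The recursion follows the first step.
walks : ℕ → ℕ → ℕ → ℕ
walks zero    zero    (suc zero) = 1
walks zero    _       _          = 0
walks (suc m) zero    zero       = 0
walks (suc m) zero    (suc j)    = walks m 1 j
walks (suc m) (suc h) j          = walks m (suc (suc h)) j + walks m h j

isEmptyWalk : ℕ → ℕ → Bool
isEmptyWalk zero (suc zero) = true
isEmptyWalk _    _          = false

isWalk : ℕ → ℕ → List Step → Bool
isWalk h       j          []      = isEmptyWalk h j
isWalk zero    _          (D ∷ w) = false
isWalk zero    zero       (U ∷ w) = false
isWalk zero    (suc j)    (U ∷ w) = isWalk 1 j w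
isWalk (suc h) j          (U ∷ w) = isWalk (suc (suc h)) j w
isWalk (suc h) j          (D ∷ w) = isWalk h j w

count-isWalk : ∀ m h j → count (isWalk h j) (allWords m) ≡ walks m h j
count-isWalk zero    zero    zero             = refl
count-isWalk zero    zero    (suc zero)       = refl
count-isWalk zero    zero    (suc (suc j))    = refl
count-isWalk zero    (suc h) j                = refl
count-isWalk (suc m) h j = trans (count-branch (isWalk h j) (allWords m)) (step h j)
  where
  step : ∀ h j → count (isWalk h j ∘ (U ∷_)) (allWords m) + count (isWalk h j ∘ (D ∷_)) (allWords m)
                   ≡ walks (suc m) h j
  step zero    zero    = cong₂ _+_ (count-false (allWords m)) (count-false (allWords m))
  step zero    (suc j) = trans (cong₂ _+_ (count-isWalk m 1 j) (count-false (allWords m))) (+-identityʳ _)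
  step (suc h) j       = cong₂ _+_ (count-isWalk m (suc (suc h)) j) (count-isWalk m h j)

-- Section 3.  The count p n 0 j is a count of walks

isDyckFrom : ℤ → List Step → Bool
isDyckFrom h w = allNonneg (heightsFrom h w) ∧ ⌊ lastℤ (heightsFrom h w) ℤ.≟ + 0 ⌋

feetFrom : ℤ → List Step → ℕ
feetFrom h w = length (filter (λ y → y ℤ.≟ + 0) (heightsFrom h w))

isDyckWithFeet : ℤ → ℕ → List Step → Bool
isDyckWithFeet h j w = ⌊ isDyckFrom h w Bool.≟ true ⌋ ∧ ⌊ feetFrom h w ℕ.≟ j ⌋

-- Deciding suc x ≡ suc j is deciding x ≡ j; both tests compute x ≡ᵇ j,
-- but the decision procedures differ in their (irrelevant) proofs.
does-suc-≟ : ∀ x j → ⌊ suc x ℕ.≟ suc j ⌋ ≡ ⌊ x ℕ.≟ j ⌋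
does-suc-≟ x j = trans (isYes≗does (suc x ℕ.≟ suc j)) (sym (isYes≗does (x ℕ.≟ j)))

isDyckWithFeet-0U : ∀ j w → isDyckWithFeet (+ 0) (suc j) (U ∷ w) ≡ isDyckWithFeet (+ 1) j w
isDyckWithFeet-0U j []      = refl
isDyckWithFeet-0U j (s ∷ w) =
  cong (⌊ isDyckFrom (+ 1) (s ∷ w) Bool.≟ true ⌋ ∧_) (does-suc-≟ (feetFrom (+ 1) (s ∷ w)) j)

isDyckWithFeet-pos : ∀ k j s w →
  isDyckWithFeet (+ suc k) j (s ∷ w) ≡ isDyckWithFeet (+ suc k ℤ.+ stepΔ s) j w
isDyckWithFeet-pos k j s []      = refl
isDyckWithFeet-pos k j s (t ∷ w) = refl

isWalk-correct : ∀ h j w → isDyckWithFeet (+ h) j w ≡ isWalk h j w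
isWalk-correct zero    zero          []          = refl
isWalk-correct zero    (suc zero)    []          = refl
isWalk-correct zero    (suc (suc j)) []          = refl
isWalk-correct (suc h) j             []          = refl
isWalk-correct zero    zero          (U ∷ w)     = ∧-zeroʳ _
isWalk-correct zero    (suc j)       (U ∷ w)     =
  trans (isDyckWithFeet-0U j w) (isWalk-correct 1 j w)
isWalk-correct zero    j             (D ∷ [])    = refl
isWalk-correct zero    j             (D ∷ s ∷ w) = refl
isWalk-correct (suc h) j             (U ∷ w)     = begin
  isDyckWithFeet (+ suc h) j (U ∷ w) ≡⟨ isDyckWithFeet-pos h j U w ⟩
  isDyckWithFeet (+ (suc h + 1)) j w ≡⟨ cong (λ x → isDyckWithFeet (+ x) j w) (+-comm (suc h) 1) ⟩
  isDyckWithFeet (+ suc (suc h)) j w ≡⟨ isWalk-correct (suc (suc h)) j w ⟩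
  isWalk (suc (suc h)) j w           ∎
isWalk-correct (suc h) j             (D ∷ w)     =
  trans (isDyckWithFeet-pos h j D w) (isWalk-correct h j w)

p≡walks : ∀ n j → p n 0 j ≡ walks (2 * n) 0 j
p≡walks n j = begin
  p n 0 j                                            ≡⟨ length-filter-filter _ _ (allWords (2 * n)) ⟩
  count (isDyckWithFeet (+ 0) j) (allWords (2 * n)) ≡⟨ count-cong (isWalk-correct 0 j) (allWords (2 * n)) ⟩
  count (isWalk 0 j) (allWords (2 * n))             ≡⟨ count-isWalk (2 * n) 0 j ⟩
  walks (2 * n) 0 j                                  ∎

-- Section 4.  Finite sums and convolutions

sumBelow : ℕ → (ℕ → ℕ) → ℕ
sumBelow zero    f = 0
sumBelow (suc N) f = f 0 + sumBelow N (f ∘ suc)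

Σ<≡sumBelow : ∀ N f → Σ< N f ≡ sumBelow N f
Σ<≡sumBelow N f = sum-applyUpTo N id
  where
  sum-applyUpTo : ∀ N g → sum (map f (applyUpTo g N)) ≡ sumBelow N (f ∘ g)
  sum-applyUpTo zero    g = refl
  sum-applyUpTo (suc N) g = cong (λ s → f (g 0) + s) (sum-applyUpTo N (g ∘ suc))

sumBelow-cong : ∀ N {f g : ℕ → ℕ} → (∀ i → f i ≡ g i) → sumBelow N f ≡ sumBelow N g
sumBelow-cong zero    f≗g = refl
sumBelow-cong (suc N) f≗g = cong₂ _+_ (f≗g 0) (sumBelow-cong N (f≗g ∘ suc))

sumBelow-zero : ∀ N {f : ℕ → ℕ} → (∀ i → f i ≡ 0) → sumBelow N f ≡ 0
sumBelow-zero zero    f≗0 = refl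
sumBelow-zero (suc N) f≗0 = cong₂ _+_ (f≗0 0) (sumBelow-zero N (f≗0 ∘ suc))

sumBelow-+ : ∀ N (f g : ℕ → ℕ) → sumBelow N (λ i → f i + g i) ≡ sumBelow N f + sumBelow N g
sumBelow-+ zero    f g = refl
sumBelow-+ (suc N) f g = begin
  (f 0 + g 0) + sumBelow N (λ i → f (suc i) + g (suc i))
    ≡⟨ cong (λ s → (f 0 + g 0) + s) (sumBelow-+ N (f ∘ suc) (g ∘ suc)) ⟩
  (f 0 + g 0) + (sumBelow N (f ∘ suc) + sumBelow N (g ∘ suc))
    ≡⟨ interchange (f 0) (g 0) (sumBelow N (f ∘ suc)) (sumBelow N (g ∘ suc)) ⟩
  (f 0 + sumBelow N (f ∘ suc)) + (g 0 + sumBelow N (g ∘ suc)) ∎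

sumBelow-last : ∀ N (f : ℕ → ℕ) → sumBelow (suc N) f ≡ sumBelow N f + f N
sumBelow-last zero    f = +-identityʳ (f 0)
sumBelow-last (suc N) f =
  trans (cong (λ s → f 0 + s) (sumBelow-last N (f ∘ suc))) (sym (+-assoc (f 0) _ (f (suc N))))

convolution : (ℕ → ℕ) → (ℕ → ℕ) → ℕ → ℕ
convolution f g m = sumBelow (suc m) (λ a → f a * g (m ∸ a))

convolution-congˡ : ∀ m {f f′ : ℕ → ℕ} (g : ℕ → ℕ) → (∀ a → f a ≡ f′ a) →
  convolution f g m ≡ convolution f′ g m
convolution-congˡ m g f≗f′ = sumBelow-cong (suc m) (λ a → cong (_* g (m ∸ a)) (f≗f′ a))

convolution-zeroˡ : ∀ m {f : ℕ → ℕ} (g : ℕ → ℕ) → (∀ a → f a ≡ 0) → convolution f g m ≡ 0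
convolution-zeroˡ m g f≗0 = sumBelow-zero (suc m) (λ a → cong (_* g (m ∸ a)) (f≗0 a))

convolution-+ˡ : ∀ m (f f′ g : ℕ → ℕ) →
  convolution (λ a → f a + f′ a) g m ≡ convolution f g m + convolution f′ g m
convolution-+ˡ m f f′ g = begin
  sumBelow (suc m) (λ a → (f a + f′ a) * g (m ∸ a))
    ≡⟨ sumBelow-cong (suc m) (λ a → *-distribʳ-+ (g (m ∸ a)) (f a) (f′ a)) ⟩
  sumBelow (suc m) (λ a → f a * g (m ∸ a) + f′ a * g (m ∸ a))
    ≡⟨ sumBelow-+ (suc m) (λ a → f a * g (m ∸ a)) (λ a → f′ a * g (m ∸ a)) ⟩
  convolution f g m + convolution f′ g m ∎

convolution-unitʳ : ∀ m (f g : ℕ → ℕ) → g 0 ≡ 1 → (∀ b → g (suc b) ≡ 0) → convolution f g m ≡ f m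
convolution-unitʳ zero    f g g0≡1 _ rewrite g0≡1 = trans (+-identityʳ _) (*-identityʳ (f 0))
convolution-unitʳ (suc m) f g g0≡1 gs≡0 rewrite gs≡0 m | *-zeroʳ (f 0) =
  convolution-unitʳ m (f ∘ suc) g g0≡1 gs≡0

two*suc : ∀ i → 2 * suc i ≡ suc (suc (2 * i))
two*suc i = *-suc 2 i

convolution-even : ∀ k (f g : ℕ → ℕ) → (∀ i → f (suc (2 * i)) ≡ 0) →
  convolution f g (2 * k) ≡ sumBelow (suc k) (λ i → f (2 * i) * g (2 * (k ∸ i)))
convolution-even zero    f g _      = refl
convolution-even (suc k) f g f-odd≡0 = begin
  convolution f g (2 * suc k)
    ≡⟨ cong (convolution f g) (two*suc k) ⟩
  f 0 * g (suc (suc (2 * k))) + (f 1 * g (suc (2 * k)) + convolution (f ∘ suc ∘ suc) g (2 * k))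
    ≡⟨ cong (λ z → f 0 * g (suc (suc (2 * k)))
                     + (z * g (suc (2 * k)) + convolution (f ∘ suc ∘ suc) g (2 * k)))
            (f-odd≡0 0) ⟩
  f 0 * g (suc (suc (2 * k))) + convolution (f ∘ suc ∘ suc) g (2 * k)
    ≡⟨ cong₂ _+_ (cong (λ z → f 0 * g z) (sym (two*suc k)))
                 (convolution-even k (f ∘ suc ∘ suc) g
                   (λ i → trans (cong (f ∘ suc) (sym (two*suc i))) (f-odd≡0 (suc i)))) ⟩
  f 0 * g (2 * suc k) + sumBelow (suc k) (λ i → f (suc (suc (2 * i))) * g (2 * (k ∸ i)))
    ≡⟨ cong (λ s → f 0 * g (2 * suc k) + s)
         (sumBelow-cong (suc k) (λ i → cong (λ z → f z * g (2 * (k ∸ i))) (sym (two*suc i)))) ⟩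
  sumBelow (suc (suc k)) (λ i → f (2 * i) * g (2 * (suc k ∸ i))) ∎

-- Section 5.  Combinatorics of walks

walks-noFeet : ∀ m h → walks m h 0 ≡ 0
walks-noFeet zero    zero    = refl
walks-noFeet zero    (suc h) = refl
walks-noFeet (suc m) zero    = refl
walks-noFeet (suc m) (suc h) = cong₂ _+_ (walks-noFeet m (suc (suc h))) (walks-noFeet m h)

walks-empty : ∀ j → j ≢ 1 → walks 0 0 j ≡ 0
walks-empty zero          _    = refl
walks-empty (suc zero)    j≢1 = ⊥-elim (j≢1 refl)
walks-empty (suc (suc j)) _    = refl

even : ℕ → Bool
even zero          = true
even (suc zero)    = false
even (suc (suc n)) = even n

even-odd : ∀ i → even (suc (2 * i)) ≡ false
even-odd zero    = refl
even-odd (suc i) = trans (cong (even ∘ suc) (two*suc i)) (even-odd i)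

-- Each step changes the height by one, so a walk from h to 0 has
-- length of the same parity as h.
walks-parity : ∀ m h j → even (h + m) ≡ false → walks m h j ≡ 0
walks-parity zero    zero    j       ()
walks-parity zero    (suc h) j       _   = refl
walks-parity (suc m) zero    zero    _   = refl
walks-parity (suc m) zero    (suc j) odd = walks-parity m 1 j odd
walks-parity (suc m) (suc h) j       odd rewrite +-suc h m =
  cong₂ _+_ (walks-parity m (suc (suc h)) j odd) (walks-parity m h j odd)

-- firstPassage m h: the number of words of length m from height h that
-- end at 0 and visit 0 only at their end (for h = 0: only the empty word).
firstPassage : ℕ → ℕ → ℕ
firstPassage zero    zero    = 1
firstPassage zero    (suc h) = 0
firstPassage (suc m) zero    = 0
firstPassage (suc m) (suc h) = firstPassage m (suc (suc h)) + firstPassage m h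

-- total m h: the number of words of length m from height h that never
-- go below 0 and end at 0, regardless of their feet.
total : ℕ → ℕ → ℕ
total zero    zero    = 1
total zero    (suc h) = 0
total (suc m) zero    = total m 1
total (suc m) (suc h) = total m (suc (suc h)) + total m h

-- First-passage decomposition: cutting a walk at its first visit of
-- level 0 gives a first passage followed by a walk from 0.
walks-firstPassage : ∀ m h j →
  walks m h j ≡ convolution (λ a → firstPassage a h) (λ b → walks b 0 j) m
walks-firstPassage zero    zero    j = sym (trans (+-identityʳ _) (+-identityʳ _))
walks-firstPassage zero    (suc h) j = refl
walks-firstPassage (suc m) zero    j =
  sym (trans (cong₂ _+_ (+-identityʳ _) (convolution-zeroˡ m (λ b → walks b 0 j) (λ _ → refl)))
             (+-identityʳ _))
walks-firstPassage (suc m) (suc h) j = begin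
  walks m (suc (suc h)) j + walks m h j
    ≡⟨ cong₂ _+_ (walks-firstPassage m (suc (suc h)) j) (walks-firstPassage m h j) ⟩
  convolution (λ a → firstPassage a (suc (suc h))) (λ b → walks b 0 j) m
    + convolution (λ a → firstPassage a h) (λ b → walks b 0 j) m
    ≡⟨ sym (convolution-+ˡ m (λ a → firstPassage a (suc (suc h))) (λ a → firstPassage a h) (λ b → walks b 0 j)) ⟩
  convolution (λ a → firstPassage (suc a) (suc h)) (λ b → walks b 0 j) m ∎

-- A walk with exactly two feet is U, a first passage from 1, and nothing more.
walks-twoFeet : ∀ a → walks (suc a) 0 2 ≡ firstPassage a 1
walks-twoFeet a = trans (walks-firstPassage a 1 1)
  (convolution-unitʳ a (λ b → firstPassage b 1) (λ b → walks b 0 1) refl (λ b → walks-noFeet b 1))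

walks-firstExcursion : ∀ m j →
  walks (suc m) 0 (suc j) ≡ convolution (λ a → walks (suc a) 0 2) (λ b → walks b 0 j) m
walks-firstExcursion m j = trans (walks-firstPassage m 1 j)
  (convolution-congˡ m (λ b → walks b 0 j) (λ a → sym (walks-twoFeet a)))

-- A first passage from h+1 is a walk from h, shifted up by one, followed by D.
firstPassage-shift : ∀ m h → firstPassage (suc m) (suc h) ≡ total m h
firstPassage-shift zero    zero    = refl
firstPassage-shift zero    (suc h) = refl
firstPassage-shift (suc m) zero    = trans (+-identityʳ _) (firstPassage-shift m 1)
firstPassage-shift (suc m) (suc h) =
  cong₂ _+_ (firstPassage-shift m (suc (suc h))) (firstPassage-shift m h)

-- A walk of length m has at most m + 1 feet, so summing over all foot
-- counts below any N ≥ m + 2 gives the total number of walks.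
walks-total : ∀ m h N → suc (suc m) ≤ N → sumBelow N (walks m h) ≡ total m h
walks-total zero    zero    (suc (suc N)) (s≤s (s≤s _)) = cong suc (sumBelow-zero N (λ _ → refl))
walks-total zero    (suc h) (suc (suc N)) (s≤s (s≤s _)) = sumBelow-zero N (λ _ → refl)
walks-total (suc m) zero    (suc N) (s≤s m+2≤N) = walks-total m 1 N m+2≤N
walks-total (suc m) (suc h) N m+3≤N = begin
  sumBelow N (λ j → walks m (suc (suc h)) j + walks m h j)
    ≡⟨ sumBelow-+ N (walks m (suc (suc h))) (walks m h) ⟩
  sumBelow N (walks m (suc (suc h))) + sumBelow N (walks m h)
    ≡⟨ cong₂ _+_ (walks-total m (suc (suc h)) N m+2≤N) (walks-total m h N m+2≤N) ⟩
  total m (suc (suc h)) + total m h ∎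
  where
  m+2≤N : suc (suc m) ≤ N
  m+2≤N = ≤-trans (n≤1+n _) m+3≤N

walks-evenDecomposition : ∀ k j → walks (2 * suc k) 0 (suc j)
  ≡ sumBelow (suc k) (λ i → walks (2 * suc i) 0 2 * walks (2 * (k ∸ i)) 0 j)
walks-evenDecomposition k j = begin
  walks (2 * suc k) 0 (suc j)
    ≡⟨ cong (λ m → walks m 0 (suc j)) (two*suc k) ⟩
  walks (suc (suc (2 * k))) 0 (suc j)
    ≡⟨ walks-firstExcursion (suc (2 * k)) j ⟩
  convolution (λ a → walks (suc (suc a)) 0 2) (λ b → walks b 0 j) (2 * k)
    ≡⟨ convolution-even k (λ a → walks (suc (suc a)) 0 2) (λ b → walks b 0 j)
         (λ i → walks-parity (suc (suc (suc (2 * i)))) 0 2 (even-odd i)) ⟩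
  sumBelow (suc k) (λ i → walks (suc (suc (2 * i))) 0 2 * walks (2 * (k ∸ i)) 0 j)
    ≡⟨ sumBelow-cong (suc k) (λ i → cong (λ m → walks m 0 2 * walks (2 * (k ∸ i)) 0 j) (sym (two*suc i))) ⟩
  sumBelow (suc k) (λ i → walks (2 * suc i) 0 2 * walks (2 * (k ∸ i)) 0 j) ∎

-- Section 6.  The four claims

p-length0 : p 0 0 1 ≡ 1 × (∀ j → j ≢ 1 → p 0 0 j ≡ 0)
p-length0 = p≡walks 0 1 , λ j j≢1 → trans (p≡walks 0 j) (walks-empty j j≢1)

-- Claim (2): the only Dyck path of length 2 is UD, which has two feet.
p-length2 : p 1 0 2 ≡ 1 × (∀ j → j ≢ 2 → p 1 0 j ≡ 0)
p-length2 = p≡walks 1 2 , λ j j≢2 → trans (p≡walks 1 j) (walks-length2 j j≢2)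
  where
  walks-length2 : ∀ j → j ≢ 2 → walks 2 0 j ≡ 0
  walks-length2 zero    _      = refl
  walks-length2 (suc j) 1+j≢2 = walks-empty j (1+j≢2 ∘ cong suc)

-- Claim (3), first part: every Dyck path starts at level 0 …
p-noFeet : ∀ n → p n 0 0 ≡ 0
p-noFeet n = trans (p≡walks n 0) (walks-noFeet (2 * n) 0)

-- … and a nonempty one also ends there.
p-oneFoot : ∀ n → p (suc n) 0 1 ≡ 0
p-oneFoot n = begin
  p (suc n) 0 1               ≡⟨ p≡walks (suc n) 1 ⟩
  walks (2 * suc n) 0 1       ≡⟨ cong (λ m → walks m 0 1) (two*suc n) ⟩
  walks (suc (suc (2 * n))) 0 1 ≡⟨ walks-noFeet (suc (2 * n)) 1 ⟩
  0                            ∎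

-- Claim (3), second part: a Dyck path with exactly two feet at level 0
-- is U P D for an arbitrary Dyck path P of length 2n.
p-twoFeet : ∀ n N → 2 * suc n ≤ N → p (suc n) 0 2 ≡ Σ< N (λ k → p n 0 k)
p-twoFeet n N 2n+2≤N = begin
  p (suc n) 0 2                  ≡⟨ p≡walks (suc n) 2 ⟩
  walks (2 * suc n) 0 2          ≡⟨ cong (λ m → walks m 0 2) (two*suc n) ⟩
  walks (suc (suc (2 * n))) 0 2  ≡⟨ walks-twoFeet (suc (2 * n)) ⟩
  firstPassage (suc (2 * n)) 1   ≡⟨ firstPassage-shift (2 * n) 0 ⟩
  total (2 * n) 0                ≡⟨ sym (walks-total (2 * n) 0 N (subst (_≤ N) (two*suc n) 2n+2≤N)) ⟩
  sumBelow N (walks (2 * n) 0)   ≡⟨ sumBelow-cong N (λ k → sym (p≡walks n k)) ⟩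
  sumBelow N (λ k → p n 0 k)     ≡⟨ sym (Σ<≡sumBelow N (λ k → p n 0 k)) ⟩
  Σ< N (λ k → p n 0 k)           ∎

-- Claim (4): a Dyck path of length 2(k+2) with j+3 feet is a first
-- excursion of length 2(i+1) followed by a Dyck path with j+2 feet; the
-- term i = k+1 vanishes since the remaining empty path has one foot.
p-manyFeet : ∀ k j → p (suc (suc k)) 0 (suc (suc (suc j)))
  ≡ Σ< (suc k) (λ i → p (i + 1) 0 2 * p (suc (suc k) ∸ i ∸ 1) 0 (suc (suc j)))
p-manyFeet k j = begin
  p (suc (suc k)) 0 (suc (suc (suc j)))
    ≡⟨ p≡walks (suc (suc k)) (suc (suc (suc j))) ⟩
  walks (2 * suc (suc k)) 0 (suc (suc (suc j)))
    ≡⟨ walks-evenDecomposition (suc k) (suc (suc j)) ⟩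
  sumBelow (suc (suc k)) term       ≡⟨ sumBelow-last (suc k) term ⟩
  sumBelow (suc k) term + term (suc k) ≡⟨ cong (λ s → sumBelow (suc k) term + s) lastTerm≡0 ⟩
  sumBelow (suc k) term + 0         ≡⟨ +-identityʳ _ ⟩
  sumBelow (suc k) term             ≡⟨ sumBelow-cong (suc k) term≡ ⟩
  sumBelow (suc k) summand          ≡⟨ sym (Σ<≡sumBelow (suc k) summand) ⟩
  Σ< (suc k) summand                ∎
  where
  term summand : ℕ → ℕ
  term i = walks (2 * suc i) 0 2 * walks (2 * (suc k ∸ i)) 0 (suc (suc j))
  summand i = p (i + 1) 0 2 * p (suc (suc k) ∸ i ∸ 1) 0 (suc (suc j))

  lastTerm≡0 : term (suc k) ≡ 0
  lastTerm≡0 rewrite n∸n≡0 k = *-zeroʳ (walks (2 * suc (suc k)) 0 2)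

  remaining : ∀ i → suc (suc k) ∸ i ∸ 1 ≡ suc k ∸ i
  remaining i = trans (∸-+-assoc (suc (suc k)) i 1) (cong (suc (suc k) ∸_) (+-comm i 1))

  term≡ : ∀ i → term i ≡ summand i
  term≡ i = sym (cong₂ _*_
    (trans (p≡walks (i + 1) 2) (cong (λ n → walks (2 * n) 0 2) (+-comm i 1)))
    (trans (p≡walks (suc (suc k) ∸ i ∸ 1) (suc (suc j)))
           (cong (λ n → walks (2 * n) 0 (suc (suc j))) (remaining i))))

mainTheorem1 : (p 0 0 1 ≡ 1 × (∀ j → j ≢ 1 → p 0 0 j ≡ 0))
    × (p 1 0 2 ≡ 1 × (∀ j → j ≢ 2 → p 1 0 j ≡ 0))
    × (∀ n → 1 < n →
    p n 0 0 ≡ 0 × p n 0 1 ≡ 0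
    × (∀ N → 2 * n ≤ N → p n 0 2 ≡ Σ< N (λ k → p (n ∸ 1) 0 k)))
    × (∀ n j → 1 < n → 2 < j →
    p n 0 j ≡ Σ< (suc (n ∸ 2)) (λ i → p (i + 1) 0 2 * p (n ∸ i ∸ 1) 0 (j ∸ 1)))
mainTheorem1 = p-length0 , p-length2 , claim3 , claim4
  where
  claim3 : ∀ n → 1 < n →
    p n 0 0 ≡ 0 × p n 0 1 ≡ 0 × (∀ N → 2 * n ≤ N → p n 0 2 ≡ Σ< N (λ k → p (n ∸ 1) 0 k))
  claim3 (suc n) (s≤s _) = p-noFeet (suc n) , p-oneFoot n , p-twoFeet n

  claim4 : ∀ n j → 1 < n → 2 < j →
    p n 0 j ≡ Σ< (suc (n ∸ 2)) (λ i → p (i + 1) 0 2 * p (n ∸ i ∸ 1) 0 (j ∸ 1))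
  claim4 (suc (suc k)) (suc (suc (suc j))) (s≤s (s≤s _)) (s≤s (s≤s (s≤s _))) = p-manyFeet k j
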